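{- Let $r,s,t$ be positive integers with $r \ge 2$ and $t \ge s \ge 2$. Then there is a constant $C = C(r,s,t)$ such that, if $n$ is large enough, every $2$-edge-coloring $E(K_n) = E(R)\cup E(B)$ with $\min\{e(R),e(B)\}\ge Cn$ that contains no monochromatic induced $rK_2$ contains an induced monochromatic member of $\mathcal{F}_{s,t} = \{K_{s,t}, S_{t,t}\}$.
   Context: A $2$-edge-coloring of $K_n$ is a partition $E(K_n)=E(R)\cup E(B)$ into red and blue edges; $e(R),e(B)$ are the numbers of red and blue edges. The coloring contains an induced monochromatic copy of a graph $H$ if there is $U\subseteq V(K_n)$ with $|U|=|V(H)|$ such that the red edges inside $U$, or the blue edges inside $U$, form a graph isomorphic to $H$. $rK_2$ is the matching with $r$ edges (disjoint union of $r$ copies of $K_2$). $K_{s,t}$ is the complete bipartite graph with parts of sizes $s,t$; $S_{t,t}$ is the complete split graph consisting of a clique on $t$ vertices, an independent set on $t$ vertices, and all edges between them. -}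

module Defs where

open import Data.Nat using (ℕ; zero; suc; _+_; _*_; _<ᵇ_; _≡ᵇ_; _/_; _⊓_)
open import Data.Bool using (Bool; true; false; not; _∧_; _∨_; _xor_; if_then_else_)
open import Data.Fin using (Fin; toℕ)
open import Data.List using (List; map; allFin)
open import Data.Nat.ListAction using (sum)
open import Data.Product using (Σ; ∃; _×_)
open import Function.Definitions using (Injective)
open import Relation.Binary.PropositionalEquality using (_≡_; _≢_)

-- A 2-edge-coloring of K_n: col x y = true means the edge xy is red,
-- false means blue.  Only values at x ≢ y matter; col must be symmetric.
record Coloring (n : ℕ) : Set where
  field
    col : Fin n → Fin n → Bool
    sym : ∀ x y → col x y ≡ col y x
open Coloring public

edgeCount : ∀ {n} → Coloring n → Bool → ℕ
edgeCount {n} χ c =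
  sum (map (λ x → sum (map (λ y →
         if (toℕ x <ᵇ toℕ y) ∧ (if c then col χ x y else not (col χ x y))
         then 1 else 0) (allFin n))) (allFin n))

eR eB : ∀ {n} → Coloring n → ℕ
eR χ = edgeCount χ true
eB χ = edgeCount χ false

record Graph : Set where
  field
    size : ℕ
    adj  : Fin size → Fin size → Bool
open Graph public

InducedMono : ∀ {n} → Coloring n → Graph → Set
InducedMono {n} χ H =
  Σ Bool λ c → Σ (Fin (size H) → Fin n) λ f →
    Injective _≡_ _≡_ f ×
    (∀ i j → i ≢ j →
       adj H i j ≡ (if c then col χ (f i) (f j) else not (col χ (f i) (f j))))

-- r K_2 : vertices 0..2r-1, edges {2m, 2m+1}
matching : ℕ → Graph
matching r = record
  { size = r + r
  ; adj  = λ i j → ((toℕ i / 2) ≡ᵇ (toℕ j / 2)) ∧ not (toℕ i ≡ᵇ toℕ j) }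

Kbip : ℕ → ℕ → Graph
Kbip s t = record
  { size = s + t
  ; adj  = λ i j → (toℕ i <ᵇ s) xor (toℕ j <ᵇ s) }

-- S_{t,t}: clique {0..t-1}, independent set {t..2t-1}, all edges between
Ssplit : ℕ → Graph
Ssplit t = record
  { size = t + t
  ; adj  = λ i j → not (toℕ i ≡ᵇ toℕ j) ∧ ((toℕ i <ᵇ t) ∨ (toℕ j <ᵇ t)) }

{-# OPTIONS --safe #-}
-- Call a colour dense if it has at least C n edges, for C a tower of Ramsey numbers. In a dense
-- colour, say red, many vertices have large red degree, so Ramsey's theorem gives a red K-clique or
-- a red-independent set X of such vertices. Refining the red neighbourhood of x ∈ X until every
-- vertex of X is complete or anticomplete to it yields a red neighbour g(x) with fewer than s red
-- neighbours in X; otherwise s vertices of X and an independent t-set of the neighbourhood span a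
-- red K_{s,t}. Ramsey's theorem for "g(u)v, g(v)u or g(u)g(v) is red" on X gives r unrelated
-- vertices, whose edges x g(x) form an induced red rK₂, or a related set; there either the partners
-- span a red K-clique or a further Ramsey step finds s vertices of X red to one partner, which is
-- impossible. So, without rK₂ and K_{s,t}, both colours contain K-cliques. Refining the blue clique
-- against 2t vertices of the red one leaves t of them complete to a blue (t+1)-clique or t
-- anticomplete to it, and either case is an induced S_{t,t}.
module Submission where

open import Defs
open import Data.Nat using (ℕ; _≤_; _*_; _⊓_)
open import Data.Product using (Σ; _×_)
open import Data.Sum using (_⊎_)
open import Relation.Nullary using (¬_)

open import Data.Bool using (Bool; true; false; not; _∧_; _∨_; _xor_; if_then_else_)
import Data.Bool as Bool
open import Data.Bool.Properties using (¬-not; not-involutive; T-≡; ∧-identityʳ)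
open import Data.Empty using (⊥-elim)
open import Data.Fin using (Fin; zero; suc; toℕ; splitAt; join; inject≤; fromℕ<)
import Data.Fin as Fin
open import Data.Fin.Properties
  using (join-splitAt; inject≤-injective; toℕ-injective; toℕ-fromℕ<; toℕ<n)
open import Data.List using (List; []; _∷_; length; filter; lookup; map; allFin; take)
open import Data.List.Properties
  using (filter-all; length-filter; length-tabulate; length-map; length-take)
open import Data.List.Membership.Propositional using (_∈_)
open import Data.List.Membership.Propositional.Properties using (∈-lookup)
open import Data.List.Relation.Binary.Sublist.Propositional
  using (_⊆_; []; _∷_; _∷ʳ_; ⊆-trans; ⊆-refl; minimum) renaming (lookup to ⊆-lookup)
open import Data.List.Relation.Binary.Sublist.Propositional.Properties
  using (filter-⊆; filter⁺; All-resp-⊆; length-mono-≤)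
open import Data.List.Relation.Unary.All as All using (All; []; _∷_; all?)
open import Data.List.Relation.Unary.All.Properties using (all-filter)
open import Data.List.Relation.Unary.AllPairs as AllPairs using (AllPairs; []; _∷_)
import Data.List.Relation.Unary.AllPairs.Properties as AllPairs
open import Data.List.Relation.Unary.Any using (here; there)
open import Data.List.Relation.Unary.Unique.Propositional.Properties using (allFin⁺)
import Data.Nat as ℕ
open import Data.Nat
  using (zero; suc; _+_; _<_; _^_; z≤n; s≤s; s≤s⁻¹; _<ᵇ_; _≡ᵇ_; _/_; ⌊_/2⌋; ⌈_/2⌉; parity; >-nonZero)
open import Data.Nat.DivMod using (m/n≡1+[m∸n]/n)
open import Data.Nat.ListAction using (sum)
open import Data.Nat.Properties
open import Algebra.Properties.CommutativeSemigroup +-commutativeSemigroup using (x∙yz≈y∙xz)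
open import Data.Parity.Base using (Parity; 0ℙ; 1ℙ)
open import Data.Product using (_,_; proj₁; proj₂)
open import Data.Sum using (inj₁; inj₂; [_,_]′)
open import Function using (id; flip; const; _∘_; Equivalence)
open import Function.Definitions using (Injective)
open import Level using (0ℓ)
open import Relation.Binary.Core using (Rel)
open import Relation.Binary.Definitions
  using (Symmetric; DecidableEquality) renaming (Decidable to Decidable₂)
open import Relation.Binary.PropositionalEquality
  using (_≡_; _≢_; refl; cong; cong₂; trans; subst) renaming (sym to ≡-sym)
open import Relation.Nullary using (yes; no; does)
open import Relation.Nullary.Decidable using (¬?; _×-dec_; _⊎-dec_)
open import Relation.Unary using (Pred; Decidable; ∁)
open import Relation.Unary.Properties using (∁?)

+-≤-split : ∀ {a b c d} → a + b ≤ c + d → a ≤ c ⊎ b ≤ d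
+-≤-split {a} {b} {c} {d} a+b≤c+d with a ≤? c
... | yes a≤c = inj₁ a≤c
... | no a≰c  = inj₂ (+-cancelˡ-≤ c b d (≤-trans (+-monoˡ-≤ b (<⇒≤ (≰⇒> a≰c))) a+b≤c+d))

2^[1+k]*m≡2^k*m+2^k*m : ∀ k m → 2 ^ suc k * m ≡ 2 ^ k * m + 2 ^ k * m
2^[1+k]*m≡2^k*m+2^k*m k m = trans (*-assoc 2 (2 ^ k) m) (cong (2 ^ k * m +_) (+-identityʳ (2 ^ k * m)))

ramseyBound : ℕ → ℕ → ℕ
ramseyBound zero    b       = 0
ramseyBound (suc a) zero    = 0
ramseyBound (suc a) (suc b) = suc (ramseyBound a (suc b) + ramseyBound (suc a) b)

module _ {A : Set} where

  length-filter-∁ : {P : Pred A 0ℓ} (P? : Decidable P) (xs : List A) →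
                    length (filter P? xs) + length (filter (∁? P?) xs) ≡ length xs
  length-filter-∁ P? [] = refl
  length-filter-∁ P? (x ∷ xs) with P? x
  ... | yes _ = cong suc (length-filter-∁ P? xs)
  ... | no _  = trans (+-suc _ _) (cong suc (length-filter-∁ P? xs))

  filter-pigeonhole : {P : Pred A 0ℓ} (P? : Decidable P) {a b : ℕ} (xs : List A) →
                      a + b ≤ length xs →
                      a ≤ length (filter P? xs) ⊎ b ≤ length (filter (∁? P?) xs)
  filter-pigeonhole P? xs a+b≤ =
    +-≤-split (≤-trans a+b≤ (≤-reflexive (≡-sym (length-filter-∁ P? xs))))

  length-take-≤ : ∀ {k} {xs : List A} → k ≤ length xs → length (take k xs) ≡ k
  length-take-≤ {k} {xs} k≤ = trans (length-take k xs) (m≤n⇒m⊓n≡m k≤)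

  Clique : Rel A 0ℓ → ℕ → List A → Set
  Clique R k Z = length Z ≡ k × AllPairs R Z

  Homogeneous : Rel A 0ℓ → A → List A → Set
  Homogeneous R p Z = All (R p) Z ⊎ All (∁ (R p)) Z

  module _ {R : Rel A 0ℓ} (R? : Decidable₂ R) where

    RamseyWitness : ℕ → ℕ → List A → Set
    RamseyWitness a b L = Σ (List A) λ Z → Z ⊆ L × (Clique R a Z ⊎ Clique (λ x y → ¬ R x y) b Z)

    ramsey : ∀ a b (L : List A) → ramseyBound a b ≤ length L → RamseyWitness a b L
    ramsey zero    b       L       _ = [] , minimum L , inj₁ (refl , [])
    ramsey (suc a) zero    L       _ = [] , minimum L , inj₂ (refl , [])
    ramsey (suc a) (suc b) (v ∷ L) (s≤s bound) with filter-pigeonhole (R? v) L bound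
    ... | inj₁ big with ramsey a (suc b) (filter (R? v) L) big
    ...   | Z , Z⊆ , inj₁ (|Z| , clique) =
            v ∷ Z , refl ∷ ⊆-trans Z⊆ (filter-⊆ (R? v) L) ,
            inj₁ (cong suc |Z| , All-resp-⊆ Z⊆ (all-filter (R? v) L) ∷ clique)
    ...   | Z , Z⊆ , inj₂ anticlique = Z , v ∷ʳ ⊆-trans Z⊆ (filter-⊆ (R? v) L) , inj₂ anticlique
    ramsey (suc a) (suc b) (v ∷ L) (s≤s bound) | inj₂ big
      with ramsey (suc a) b (filter (∁? (R? v)) L) big
    ...   | Z , Z⊆ , inj₁ clique = Z , v ∷ʳ ⊆-trans Z⊆ (filter-⊆ (∁? (R? v)) L) , inj₁ clique
    ...   | Z , Z⊆ , inj₂ (|Z| , anticlique) =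
            v ∷ Z , refl ∷ ⊆-trans Z⊆ (filter-⊆ (∁? (R? v)) L) ,
            inj₂ (cong suc |Z| , All-resp-⊆ Z⊆ (all-filter (∁? (R? v)) L) ∷ anticlique)

    homogeneousSublist : (P : List A) (k : ℕ) (L : List A) → 2 ^ length P * k ≤ length L →
                         Σ (List A) λ Z → Z ⊆ L × k ≤ length Z × All (λ p → Homogeneous R p Z) P
    homogeneousSublist [] k L bound =
      L , ⊆-refl , ≤-trans (≤-reflexive (≡-sym (+-identityʳ k))) bound , []
    homogeneousSublist (p ∷ P) k L bound
      with filter-pigeonhole (R? p) L
             (≤-trans (≤-reflexive (≡-sym (2^[1+k]*m≡2^k*m+2^k*m (length P) k))) bound)
    ... | inj₁ big with homogeneousSublist P k (filter (R? p) L) big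
    ...   | Z , Z⊆ , |Z| , hom =
            Z , ⊆-trans Z⊆ (filter-⊆ (R? p) L) , |Z| ,
            inj₁ (All-resp-⊆ Z⊆ (all-filter (R? p) L)) ∷ hom
    homogeneousSublist (p ∷ P) k L bound | inj₂ big
      with homogeneousSublist P k (filter (∁? (R? p)) L) big
    ...   | Z , Z⊆ , |Z| , hom =
            Z , ⊆-trans Z⊆ (filter-⊆ (∁? (R? p)) L) , |Z| ,
            inj₂ (All-resp-⊆ Z⊆ (all-filter (∁? (R? p)) L)) ∷ hom

  AllPairs-∈ : {R : Rel A 0ℓ} → Symmetric R → {xs : List A} → AllPairs R xs →
               ∀ {u v} → u ∈ xs → v ∈ xs → u ≢ v → R u v
  AllPairs-∈ R-sym (u∼ ∷ _) (here refl) (here refl) u≢v = ⊥-elim (u≢v refl)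
  AllPairs-∈ R-sym (u∼ ∷ _) (here refl) (there v∈) _   = All.lookup u∼ v∈
  AllPairs-∈ R-sym (v∼ ∷ _) (there u∈) (here refl) _   = R-sym (All.lookup v∼ u∈)
  AllPairs-∈ R-sym (_ ∷ ap) (there u∈) (there v∈) u≢v = AllPairs-∈ R-sym ap u∈ v∈ u≢v

  AllPairs-resp-⊆ : {R : Rel A 0ℓ} {xs ys : List A} → xs ⊆ ys → AllPairs R ys → AllPairs R xs
  AllPairs-resp-⊆ []        []        = []
  AllPairs-resp-⊆ (y ∷ʳ τ)  (_ ∷ ap)  = AllPairs-resp-⊆ τ ap
  AllPairs-resp-⊆ (refl ∷ τ) (y∼ ∷ ap) = All-resp-⊆ τ y∼ ∷ AllPairs-resp-⊆ τ ap

  lookup-injective : {xs : List A} → AllPairs _≢_ xs → Injective _≡_ _≡_ (lookup xs)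
  lookup-injective {x ∷ xs} (x∉ ∷ _) {zero}  {zero}  _ = refl
  lookup-injective {x ∷ xs} (x∉ ∷ _) {zero}  {suc j} e = ⊥-elim (All.lookup x∉ (∈-lookup j) e)
  lookup-injective {x ∷ xs} (x∉ ∷ _) {suc i} {zero}  e = ⊥-elim (All.lookup x∉ (∈-lookup i) (≡-sym e))
  lookup-injective {x ∷ xs} (_ ∷ u)  {suc i} {suc j} e = cong suc (lookup-injective u e)

  length-≤-filter : {P : Pred A 0ℓ} (P? : Decidable P) {W X : List A} →
                    W ⊆ X → All P W → length W ≤ length (filter P? X)
  length-≤-filter {P} P? {W} {X} W⊆X all = begin
    length W              ≡⟨ cong length (≡-sym (filter-all P? all)) ⟩
    length (filter P? W)  ≤⟨ length-mono-≤ (filter⁺ P? P? (λ { refl p → p }) W⊆X) ⟩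
    length (filter P? X)  ∎
    where open ≤-Reasoning

  lastDominates : {F : Rel A 0ℓ} (w : A) (W : List A) → (∀ {v} → v ∈ w ∷ W → F v v) →
                  AllPairs (flip F) (w ∷ W) → Σ A λ v → v ∈ w ∷ W × All (F v) (w ∷ W)
  lastDominates w []       F-refl _ = w , here refl , F-refl (here refl) ∷ []
  lastDominates w (w′ ∷ W) F-refl (w∼ ∷ ap) with lastDominates w′ W (λ v∈ → F-refl (there v∈)) ap
  ... | v , v∈ , dom = v , there v∈ , All.lookup w∼ v∈ ∷ dom

  AllPairs-map-∈ : {R S : Rel A 0ℓ} {xs : List A} →
                   (∀ {u v} → u ∈ xs → v ∈ xs → R u v → S u v) → AllPairs R xs → AllPairs S xs
  AllPairs-map-∈ f []         = []
  AllPairs-map-∈ f (u∼ ∷ ap) =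
    All.tabulate (λ v∈ → f (here refl) (there v∈) (All.lookup u∼ v∈)) ∷
    AllPairs-map-∈ (λ u∈ v∈ → f (there u∈) (there v∈)) ap

  sequence-⊎ : {O : Set} {Q : Pred A 0ℓ} (X : List A) →
               (∀ {x} → x ∈ X → O ⊎ Q x) → O ⊎ All Q X
  sequence-⊎ []      _ = inj₂ []
  sequence-⊎ (x ∷ X) f with f (here refl) | sequence-⊎ X (f ∘ there)
  ... | inj₁ o  | _        = inj₁ o
  ... | inj₂ _  | inj₁ o   = inj₁ o
  ... | inj₂ qx | inj₂ qX  = inj₂ (qx ∷ qX)

  All-choice : {B : Set} {P : A → B → Set} → DecidableEquality A → (A → B) → {X : List A} →
               All (λ x → Σ B (P x)) X → Σ (A → B) λ g → All (λ x → P x (g x)) X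
  All-choice _≟_ g₀ []                 = g₀ , []
  All-choice {P = P} _≟_ g₀ {x ∷ _} ((b , pb) ∷ rest) with All-choice _≟_ g₀ rest
  ... | g , all = g′ , new ∷ All.map old all
    where
      g′ : A → _
      g′ y = if does (y ≟ x) then b else g y

      new : P x (g′ x)
      new with x ≟ x
      ... | yes _  = pb
      ... | no x≢x = ⊥-elim (x≢x refl)

      old : ∀ {y} → P y (g y) → P y (g′ y)
      old {y} py with y ≟ x
      ... | yes refl = pb
      ... | no _     = py

  sum-mono-≤ : {f g : A → ℕ} → (∀ x → f x ≤ g x) → ∀ xs → sum (map f xs) ≤ sum (map g xs)
  sum-mono-≤ f≤g []       = z≤n
  sum-mono-≤ f≤g (x ∷ xs) = +-mono-≤ (f≤g x) (sum-mono-≤ f≤g xs)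

  sum-indicator-≤ : (b : A → Bool) {P : Pred A 0ℓ} (P? : Decidable P) →
                    (∀ y → b y ≡ true → P y) →
                    ∀ xs → sum (map (λ y → if b y then 1 else 0) xs) ≤ length (filter P? xs)
  sum-indicator-≤ b P? b⇒P [] = z≤n
  sum-indicator-≤ b P? b⇒P (y ∷ ys) with b y in by | P? y
  ... | true  | yes _  = s≤s (sum-indicator-≤ b P? b⇒P ys)
  ... | true  | no ¬Py = ⊥-elim (¬Py (b⇒P y by))
  ... | false | yes _  = m≤n⇒m≤1+n (sum-indicator-≤ b P? b⇒P ys)
  ... | false | no _   = sum-indicator-≤ b P? b⇒P ys

  sum-≤-filter : (f : A → ℕ) {P : Pred A 0ℓ} (P? : Decidable P) {a b : ℕ} →
                 (∀ x → f x ≤ a) → (∀ x → ¬ P x → f x ≤ b) →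
                 ∀ xs → sum (map f xs) ≤ length (filter P? xs) * a + length xs * b
  sum-≤-filter f P? f≤a f≤b [] = z≤n
  sum-≤-filter f P? {a} {b} f≤a f≤b (x ∷ xs) with P? x
  ... | yes _  = begin
    f x + sum (map f xs)             ≤⟨ +-mono-≤ (f≤a x) (sum-≤-filter f P? f≤a f≤b xs) ⟩
    a + (F * a + L * b)              ≡⟨ ≡-sym (+-assoc a (F * a) (L * b)) ⟩
    (a + F * a) + L * b              ≤⟨ +-monoʳ-≤ (a + F * a) (m≤n+m (L * b) b) ⟩
    (a + F * a) + (b + L * b)        ∎
    where open ≤-Reasoning
          F = length (filter P? xs)
          L = length xs
  ... | no ¬Px = begin
    f x + sum (map f xs)             ≤⟨ +-mono-≤ (f≤b x ¬Px) (sum-≤-filter f P? f≤a f≤b xs) ⟩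
    b + (F * a + L * b)              ≡⟨ x∙yz≈y∙xz b (F * a) (L * b) ⟩
    F * a + (b + L * b)              ∎
    where open ≤-Reasoning
          F = length (filter P? xs)
          L = length xs

⊆-allFin-distinct : ∀ {n} {Z : List (Fin n)} → Z ⊆ allFin n → AllPairs _≢_ Z
⊆-allFin-distinct {n} Z⊆ = AllPairs-resp-⊆ Z⊆ (allFin⁺ n)

isLeft : {X Y : Set} → X ⊎ Y → Bool
isLeft = [ const true , const false ]′

<ᵇ-splitAt : ∀ p {q} (i : Fin (p + q)) → (toℕ i <ᵇ p) ≡ isLeft (splitAt p i)
<ᵇ-splitAt zero    i       = refl
<ᵇ-splitAt (suc p) zero    = refl
<ᵇ-splitAt (suc p) (suc i) with splitAt p i in eq
... | inj₁ _ = trans (<ᵇ-splitAt p i) (cong isLeft eq)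
... | inj₂ _ = trans (<ᵇ-splitAt p i) (cong isLeft eq)

splitAt-injective : ∀ p {q} → Injective _≡_ _≡_ (splitAt p {q})
splitAt-injective p {q} {i} {j} e =
  trans (≡-sym (join-splitAt p q i)) (trans (cong (join p q) e) (join-splitAt p q j))

≢⇒≡ᵇ-false : ∀ {m n} → m ≢ n → (m ≡ᵇ n) ≡ false
≢⇒≡ᵇ-false {m} {n} m≢n = ¬-not (λ e → m≢n (≡ᵇ⇒≡ m n (Equivalence.from T-≡ e)))

m/2≡⌊m/2⌋ : ∀ m → m / 2 ≡ ⌊ m /2⌋
m/2≡⌊m/2⌋ zero          = refl
m/2≡⌊m/2⌋ (suc zero)    = refl
m/2≡⌊m/2⌋ (suc (suc m)) =
  trans (m/n≡1+[m∸n]/n {suc (suc m)} (s≤s (s≤s z≤n))) (cong suc (m/2≡⌊m/2⌋ m))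

⌊m/2⌋<n : ∀ {m n} → m < n + n → ⌊ m /2⌋ < n
⌊m/2⌋<n {m} {n} m<2n = ≰⇒> λ n≤⌊m/2⌋ → <⇒≱ m<2n (begin
  n + n               ≤⟨ +-mono-≤ n≤⌊m/2⌋ (≤-trans n≤⌊m/2⌋ (⌊n/2⌋≤⌈n/2⌉ m)) ⟩
  ⌊ m /2⌋ + ⌈ m /2⌉   ≡⟨ ⌊n/2⌋+⌈n/2⌉≡n m ⟩
  m                   ∎)
  where open ≤-Reasoning

⌊/2⌋-parity-injective : ∀ {a b} → ⌊ a /2⌋ ≡ ⌊ b /2⌋ → parity a ≡ parity b → a ≡ b
⌊/2⌋-parity-injective {zero}        {zero}        _ _ = refl
⌊/2⌋-parity-injective {suc zero}    {suc zero}    _ _ = refl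
⌊/2⌋-parity-injective {suc (suc a)} {suc (suc b)} h p =
  cong (λ c → suc (suc c)) (⌊/2⌋-parity-injective {a} {b} (suc-injective h) p)
⌊/2⌋-parity-injective {zero}        {suc zero}    _ ()
⌊/2⌋-parity-injective {suc zero}    {zero}        _ ()
⌊/2⌋-parity-injective {zero}        {suc (suc b)} () _
⌊/2⌋-parity-injective {suc zero}    {suc (suc b)} () _
⌊/2⌋-parity-injective {suc (suc a)} {zero}        () _
⌊/2⌋-parity-injective {suc (suc a)} {suc zero}    () _

pairIndex : ∀ r → Fin (r + r) → Fin r
pairIndex r i = fromℕ< (⌊m/2⌋<n (toℕ<n i))

⌊/2⌋-≡⇒pairIndex-≡ : ∀ r {i j : Fin (r + r)} →
                     ⌊ toℕ i /2⌋ ≡ ⌊ toℕ j /2⌋ → pairIndex r i ≡ pairIndex r j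
⌊/2⌋-≡⇒pairIndex-≡ r same =
  toℕ-injective (trans (toℕ-fromℕ< _) (trans same (≡-sym (toℕ-fromℕ< _))))

pairIndex-≡⇒⌊/2⌋-≡ : ∀ r {i j : Fin (r + r)} →
                     pairIndex r i ≡ pairIndex r j → ⌊ toℕ i /2⌋ ≡ ⌊ toℕ j /2⌋
pairIndex-≡⇒⌊/2⌋-≡ r same =
  trans (≡-sym (toℕ-fromℕ< _)) (trans (cong toℕ same) (toℕ-fromℕ< _))

endpoint : {X : Set} → (X → X) → Parity → X → X
endpoint g 0ℙ u = u
endpoint g 1ℙ u = g u

block : {X Y : Set} → Bool → Bool → Bool → X ⊎ Y → X ⊎ Y → Bool
block α β γ (inj₁ _) (inj₁ _) = α
block α β γ (inj₁ _) (inj₂ _) = γ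
block α β γ (inj₂ _) (inj₁ _) = γ
block α β γ (inj₂ _) (inj₂ _) = β

swapColours : ∀ {n} → Coloring n → Coloring n
swapColours χ = record
  { col = λ u v → not (col χ u v)
  ; sym = λ u v → cong not (Coloring.sym χ u v)
  }

InducedMono-swap : ∀ {n} (χ : Coloring n) H → InducedMono (swapColours χ) H → InducedMono χ H
InducedMono-swap χ H (c , f , f-inj , f-adj) =
  not c , f , f-inj , λ i j i≢j → trans (f-adj i j i≢j) (flip-colour c)
  where
    flip-colour : ∀ {x} c → (if c then not x else not (not x)) ≡ (if not c then x else not x)
    flip-colour true  = refl
    flip-colour false = not-involutive _

module _ {n : ℕ} (χ : Coloring n) where

  Edge : Bool → Rel (Fin n) 0ℓ
  Edge c u v = u ≢ v × col χ u v ≡ c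

  Red : Rel (Fin n) 0ℓ
  Red = Edge true

  edge? : ∀ c → Decidable₂ (Edge c)
  edge? c u v = ¬? (u Fin.≟ v) ×-dec (col χ u v Bool.≟ c)

  red? : Decidable₂ Red
  red? = edge? true

  Edge-sym : ∀ {c} → Symmetric (Edge c)
  Edge-sym (u≢v , uv) = (λ e → u≢v (≡-sym e)) , trans (Coloring.sym χ _ _) uv

  ¬Red⇒Blue : ∀ {u v} → u ≢ v → ¬ Red u v → Edge false u v
  ¬Red⇒Blue u≢v ¬red = u≢v , ¬-not (λ uv → ¬red (u≢v , uv))

  Red⇒¬Blue : ∀ {u v} → Red u v → ¬ Edge false u v
  Red⇒¬Blue (_ , red) (_ , blue) with () ← trans (≡-sym red) blue

  nonRed⇒Blue : ∀ {Z} → AllPairs _≢_ Z → AllPairs (λ u v → ¬ Red u v) Z → AllPairs (Edge false) Z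
  nonRed⇒Blue distinct nonRed =
    AllPairs.zipWith (λ (u≢v , ¬red) → ¬Red⇒Blue u≢v ¬red) (distinct , nonRed)

  Between : Bool → List (Fin n) → List (Fin n) → Set
  Between c A B = ∀ {u v} → u ∈ A → v ∈ B → Edge c u v

  enumerate : (A : List (Fin n)) {p : ℕ} → p ≤ length A → Fin p → Fin n
  enumerate A p≤ i = lookup A (inject≤ i p≤)

  enumerate-injective : ∀ {c A p} (p≤ : p ≤ length A) → AllPairs (Edge c) A →
                        Injective _≡_ _≡_ (enumerate A p≤)
  enumerate-injective p≤ clique e =
    inject≤-injective p≤ p≤ _ _ (lookup-injective (AllPairs.map proj₁ clique) e)

  enumerate-colour : ∀ {c A p} (p≤ : p ≤ length A) → AllPairs (Edge c) A →
                     ∀ {i j} → i ≢ j → col χ (enumerate A p≤ i) (enumerate A p≤ j) ≡ c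
  enumerate-colour p≤ clique i≢j =
    proj₂ (AllPairs-∈ Edge-sym clique (∈-lookup _) (∈-lookup _)
                      (λ e → i≢j (enumerate-injective p≤ clique e)))

  twoPartCopy : ∀ {α β γ p q A B} (adjH : Fin (p + q) → Fin (p + q) → Bool) →
                AllPairs (Edge α) A → AllPairs (Edge β) B → Between γ A B →
                (p≤ : p ≤ length A) (q≤ : q ≤ length B) →
                (∀ i j → i ≢ j → adjH i j ≡ block α β γ (splitAt p i) (splitAt p j)) →
                InducedMono χ (record { size = p + q ; adj = adjH })
  twoPartCopy {α} {β} {γ} {p} {q} {A} {B} adjH A-clique B-clique between p≤ q≤ shape =
    true , embed ∘ splitAt p , splitAt-injective p ∘ embed-injective ,
    λ i j i≢j → trans (shape i j i≢j) (block-colour (λ e → i≢j (splitAt-injective p e)))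
    where
      embed : Fin p ⊎ Fin q → Fin n
      embed = [ enumerate A p≤ , enumerate B q≤ ]′

      embed-injective : Injective _≡_ _≡_ embed
      embed-injective {inj₁ a} {inj₁ b} e = cong inj₁ (enumerate-injective p≤ A-clique e)
      embed-injective {inj₁ a} {inj₂ b} e = ⊥-elim (proj₁ (between (∈-lookup _) (∈-lookup _)) e)
      embed-injective {inj₂ a} {inj₁ b} e =
        ⊥-elim (proj₁ (between (∈-lookup _) (∈-lookup _)) (≡-sym e))
      embed-injective {inj₂ a} {inj₂ b} e = cong inj₂ (enumerate-injective q≤ B-clique e)

      block-colour : ∀ {x y} → x ≢ y → block α β γ x y ≡ col χ (embed x) (embed y)
      block-colour {inj₁ a} {inj₁ b} x≢y =
        ≡-sym (enumerate-colour p≤ A-clique (λ e → x≢y (cong inj₁ e)))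
      block-colour {inj₁ a} {inj₂ b} _   = ≡-sym (proj₂ (between (∈-lookup _) (∈-lookup _)))
      block-colour {inj₂ a} {inj₁ b} _   = ≡-sym (proj₂ (Edge-sym (between (∈-lookup _) (∈-lookup _))))
      block-colour {inj₂ a} {inj₂ b} x≢y =
        ≡-sym (enumerate-colour q≤ B-clique (λ e → x≢y (cong inj₂ e)))

  kbipCopy : ∀ {s t A B} → AllPairs (Edge false) A → AllPairs (Edge false) B → Between true A B →
             s ≤ length A → t ≤ length B → InducedMono χ (Kbip s t)
  kbipCopy {s} A-indep B-indep between s≤ t≤ =
    twoPartCopy _ A-indep B-indep between s≤ t≤ λ i j _ →
      trans (cong₂ _xor_ (<ᵇ-splitAt s i) (<ᵇ-splitAt s j)) (xor-block (splitAt s i) (splitAt s j))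
    where
      xor-block : ∀ {X Y : Set} (x y : X ⊎ Y) → (isLeft x xor isLeft y) ≡ block false false true x y
      xor-block (inj₁ _) (inj₁ _) = refl
      xor-block (inj₁ _) (inj₂ _) = refl
      xor-block (inj₂ _) (inj₁ _) = refl
      xor-block (inj₂ _) (inj₂ _) = refl

  splitCopy : ∀ {t A B} → AllPairs (Edge true) A → AllPairs (Edge false) B → Between true A B →
              t ≤ length A → t ≤ length B → InducedMono χ (Ssplit t)
  splitCopy {t} A-clique B-indep between t≤A t≤B =
    twoPartCopy _ A-clique B-indep between t≤A t≤B λ i j i≢j →
      trans (cong₂ (λ e o → not e ∧ o) (≢⇒≡ᵇ-false (λ e → i≢j (toℕ-injective e)))
                                       (cong₂ _∨_ (<ᵇ-splitAt t i) (<ᵇ-splitAt t j)))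
            (or-block (splitAt t i) (splitAt t j))
    where
      or-block : ∀ {X Y : Set} (x y : X ⊎ Y) → (isLeft x ∨ isLeft y) ≡ block true false true x y
      or-block (inj₁ _) (inj₁ _) = refl
      or-block (inj₁ _) (inj₂ _) = refl
      or-block (inj₂ _) (inj₁ _) = refl
      or-block (inj₂ _) (inj₂ _) = refl

  Separated : (Fin n → Fin n) → Rel (Fin n) 0ℓ
  Separated g u v = ∀ a b → Edge false (endpoint g a u) (endpoint g b v)

  Separated-sym : ∀ {g} → Symmetric (Separated g)
  Separated-sym sep a b = Edge-sym (sep b a)

  endpoints-Red : ∀ {g a b u} → a ≢ b → Red u (g u) → Red (endpoint g a u) (endpoint g b u)
  endpoints-Red {a = 0ℙ} {0ℙ} a≢b _   = ⊥-elim (a≢b refl)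
  endpoints-Red {a = 0ℙ} {1ℙ} _   red = red
  endpoints-Red {a = 1ℙ} {0ℙ} _   red = Edge-sym red
  endpoints-Red {a = 1ℙ} {1ℙ} a≢b _   = ⊥-elim (a≢b refl)

  matchingCopy : ∀ {r M} (g : Fin n → Fin n) (r≤ : r ≤ length M) →
                 All (λ u → Red u (g u)) M → AllPairs (Separated g) M → InducedMono χ (matching r)
  matchingCopy {r} {M} g r≤ matched separated = true , f , f-injective ,
    λ i j i≢j → trans (cong₂ _∧_ (cong₂ _≡ᵇ_ (m/2≡⌊m/2⌋ (toℕ i)) (m/2≡⌊m/2⌋ (toℕ j)))
                                 (cong not (≢⇒≡ᵇ-false (λ e → i≢j (toℕ-injective e)))))
                      (trans (∧-identityʳ _) (≡-sym (proj₂ (f-edge i≢j))))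
    where
      M-indep : AllPairs (Edge false) M
      M-indep = AllPairs.map (λ sep → sep 0ℙ 0ℙ) separated

      x : Fin r → Fin n
      x = enumerate M r≤

      f : Fin (r + r) → Fin n
      f i = endpoint g (parity (toℕ i)) (x (pairIndex r i))

      f-edge : ∀ {i j} → i ≢ j → Edge (⌊ toℕ i /2⌋ ≡ᵇ ⌊ toℕ j /2⌋) (f i) (f j)
      f-edge {i} {j} i≢j with ⌊ toℕ i /2⌋ ℕ.≟ ⌊ toℕ j /2⌋
      ... | yes same rewrite Equivalence.to T-≡ (≡⇒≡ᵇ _ _ same) =
        subst (λ k → Red (f i) (endpoint g (parity (toℕ j)) (x k))) (⌊/2⌋-≡⇒pairIndex-≡ r same)
          (endpoints-Red (λ e → i≢j (toℕ-injective (⌊/2⌋-parity-injective same e)))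
                         (All.lookup matched (∈-lookup _)))
      ... | no differ rewrite ≢⇒≡ᵇ-false differ =
        AllPairs-∈ Separated-sym separated (∈-lookup _) (∈-lookup _)
          (λ e → differ (pairIndex-≡⇒⌊/2⌋-≡ r (enumerate-injective r≤ M-indep e)))
          (parity (toℕ i)) (parity (toℕ j))

      f-injective : Injective _≡_ _≡_ f
      f-injective {i} {j} e with i Fin.≟ j
      ... | yes i≡j = i≡j
      ... | no i≢j  = ⊥-elim (proj₁ (f-edge i≢j) e)

  redDegree : Fin n → ℕ
  redDegree x = length (filter (red? x) (allFin n))

  highVertices : ℕ → List (Fin n)
  highVertices D = filter (λ x → D ≤? redDegree x) (allFin n)

  eR≤highVertices : ∀ D → eR χ ≤ length (highVertices D) * n + n * D
  eR≤highVertices D = begin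
    eR χ
      ≤⟨ sum-mono-≤ (λ x → sum-indicator-≤ _ (red? x) ordered⇒Red (allFin n)) (allFin n) ⟩
    sum (map redDegree (allFin n))
      ≤⟨ sum-≤-filter redDegree (λ x → D ≤? redDegree x) degree≤n low (allFin n) ⟩
    length (highVertices D) * n + length (allFin n) * D
      ≡⟨ cong (λ k → length (highVertices D) * n + k * D) (length-tabulate {n = n} id) ⟩
    length (highVertices D) * n + n * D
      ∎
    where
      open ≤-Reasoning

      ordered⇒Red : ∀ {x} y → ((toℕ x <ᵇ toℕ y) ∧ col χ x y) ≡ true → Red x y
      ordered⇒Red {x} y e with toℕ x <ᵇ toℕ y in x<y
      ... | true = (λ x≡y → <-irrefl (cong toℕ x≡y) (<ᵇ⇒< _ _ (Equivalence.from T-≡ x<y))) , e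

      degree≤n : ∀ x → redDegree x ≤ n
      degree≤n x =
        ≤-trans (length-filter (red? x) (allFin n)) (≤-reflexive (length-tabulate {n = n} id))

      low : ∀ x → ¬ D ≤ redDegree x → redDegree x ≤ D
      low x D≰ = <⇒≤ (≰⇒> D≰)

  manyHighVertices : ∀ {h D} → 1 ≤ n → (h + D) * n ≤ eR χ → h ≤ length (highVertices D)
  manyHighVertices {h} {D} n≥1 dense with h ≤? length (highVertices D)
  ... | yes enough = enough
  ... | no few = ⊥-elim (<⇒≱ (begin-strict
    H * n + n * D   <⟨ +-monoˡ-< (n * D) (*-monoˡ-< n {{>-nonZero n≥1}} (≰⇒> few)) ⟩
    h * n + n * D   ≡⟨ cong (h * n +_) (*-comm n D) ⟩
    h * n + D * n   ≡⟨ ≡-sym (*-distribʳ-+ n h D) ⟩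
    (h + D) * n     ∎) (≤-trans dense (eR≤highVertices D)))
    where
      open ≤-Reasoning
      H = length (highVertices D)

module Bounds (r s t K : ℕ) where

  blockSize linkedSize anchorCount degreeThreshold highCount edgeDensity : ℕ
  blockSize       = ramseyBound K t
  linkedSize      = ramseyBound K (ramseyBound s s)
  anchorCount     = ramseyBound linkedSize r
  degreeThreshold = 2 ^ anchorCount * blockSize
  highCount       = ramseyBound K anchorCount
  edgeDensity     = highCount + degreeThreshold

-- s, t and K are positive so that the sets extracted below by Ramsey's theorem are nonempty.
module DenseRedGraph {n : ℕ} (χ : Coloring n) (r s′ t′ K′ : ℕ) where

  s t K : ℕ
  s = suc s′
  t = suc t′
  K = suc K′

  open Bounds r s t K

  CliqueOrCopy : Set
  CliqueOrCopy =
    Σ (List (Fin n)) (Clique (Red χ) K) ⊎ InducedMono χ (matching r) ⊎ InducedMono χ (Kbip s t)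

  cliqueOrBipartite : ∀ {A Z} → AllPairs (Edge χ false) A → s ≤ length A → Z ⊆ allFin n →
                      blockSize ≤ length Z → Between χ true A Z → CliqueOrCopy
  cliqueOrBipartite A-indep s≤ Z⊆ big between with ramsey (red? χ) K t _ big
  ... | Y , _   , inj₁ clique         = inj₁ (Y , clique)
  ... | Y , Y⊆Z , inj₂ (|Y| , nonRed) =
    inj₂ (inj₂ (kbipCopy χ A-indep (nonRed⇒Blue χ (⊆-allFin-distinct (⊆-trans Y⊆Z Z⊆)) nonRed)
                  (λ u∈ v∈ → between u∈ (⊆-lookup Y⊆Z v∈)) s≤ (≤-reflexive (≡-sym |Y|))))

  Partner : List (Fin n) → Rel (Fin n) 0ℓ
  Partner X x y = Red χ x y × length (filter (red? χ y) X) < s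

  partnerOrCliqueOrCopy : ∀ {X x} → AllPairs (Edge χ false) X → length X ≡ anchorCount →
                          degreeThreshold ≤ redDegree χ x → CliqueOrCopy ⊎ Σ (Fin n) (Partner X x)
  partnerOrCliqueOrCopy {X} {x} X-indep |X| high
    with homogeneousSublist (red? χ) X blockSize (filter (red? χ x) (allFin n))
           (subst (λ k → 2 ^ k * blockSize ≤ redDegree χ x) (≡-sym |X|) high)
  ... | [] , _ , () , _
  ... | y ∷ Z , Z⊆N , big , homogeneous with length (filter (red? χ y) X) <? s
  ...   | yes few  = inj₂ (y , All.head (All-resp-⊆ Z⊆N (all-filter (red? χ x) (allFin n))) , few)
  ...   | no many = inj₁ (cliqueOrBipartite (AllPairs.filter⁺ (red? χ y) X-indep) (≮⇒≥ many)
                            (⊆-trans Z⊆N (filter-⊆ (red? χ x) (allFin n))) big between)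
    where
      between : Between χ true (filter (red? χ y) X) (y ∷ Z)
      between u∈ v∈ with All.lookup homogeneous (⊆-lookup (filter-⊆ (red? χ y) X) u∈)
      ... | inj₁ allRed    = All.lookup allRed v∈
      ... | inj₂ allNonRed =
        ⊥-elim (All.head allNonRed (Edge-sym χ (All.lookup (all-filter (red? χ y) X) u∈)))

  module Partners {X} (X-indep : AllPairs (Edge χ false) X) (g : Fin n → Fin n)
                  (partner : All (λ x → Partner X x (g x)) X) where

    Crossed Linked : Rel (Fin n) 0ℓ
    Crossed u v = Red χ (g u) v ⊎ Red χ (g v) u
    Linked u v  = Red χ (g u) (g v) ⊎ Crossed u v

    linked? : Decidable₂ Linked
    linked? u v = red? χ (g u) (g v) ⊎-dec (red? χ (g u) v ⊎-dec red? χ (g v) u)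

    partner-red : ∀ {v} → v ∈ X → Red χ (g v) v
    partner-red v∈ = Edge-sym χ (proj₁ (All.lookup partner v∈))

    unlinked⇒separated : ∀ {u v} → u ∈ X → v ∈ X → Edge χ false u v → ¬ Linked u v →
                         Separated χ g u v
    unlinked⇒separated {u} {v} u∈ v∈ blue unlinked = separated
      where
        toPartner : ∀ {a b} → b ∈ X → Edge χ false b a → ¬ Red χ (g b) a → Edge χ false a (g b)
        toPartner {a} {b} b∈ ba ¬red = Edge-sym χ (¬Red⇒Blue χ gb≢a ¬red)
          where
            gb≢a : g b ≢ a
            gb≢a gb≡a = Red⇒¬Blue χ (subst (Red χ b) gb≡a (proj₁ (All.lookup partner b∈))) ba

        separated : Separated χ g u v
        separated 0ℙ 0ℙ = blue
        separated 0ℙ 1ℙ = toPartner v∈ (Edge-sym χ blue) (unlinked ∘ inj₂ ∘ inj₂)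
        separated 1ℙ 0ℙ = Edge-sym χ (toPartner u∈ blue (unlinked ∘ inj₂ ∘ inj₁))
        separated 1ℙ 1ℙ = ¬Red⇒Blue χ gu≢gv (unlinked ∘ inj₁)
          where
            gu≢gv : g u ≢ g v
            gu≢gv gu≡gv = unlinked (inj₂ (inj₁ (subst (λ w → Red χ w v) (≡-sym gu≡gv) (partner-red v∈))))

    noDominatingPartner : ∀ {v W} → v ∈ X → W ⊆ X → length W ≡ s → ¬ All (Red χ (g v)) W
    noDominatingPartner {v} v∈ W⊆X |W| dominated =
      <⇒≱ (proj₂ (All.lookup partner v∈))
          (subst (_≤ _) |W| (length-≤-filter (red? χ (g v)) W⊆X dominated))

    noCrossedSet : ∀ {P} → P ⊆ X → ramseyBound s s ≤ length P → ¬ AllPairs Crossed P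
    noCrossedSet P⊆X big crossed with ramsey (λ u v → red? χ (g u) v) s s _ big
    ... | [] , _ , inj₁ (() , _)
    ... | [] , _ , inj₂ (() , _)
    ... | w ∷ W , W⊆P , inj₁ (|W| , forward ∷ _) =
      noDominatingPartner w∈X W⊆X |W| (partner-red w∈X ∷ forward)
      where
        W⊆X = ⊆-trans W⊆P P⊆X
        w∈X = ⊆-lookup W⊆X (here refl)
    ... | w ∷ W , W⊆P , inj₂ (|W| , nonForward)
      with lastDominates w W (partner-red ∘ ⊆-lookup (⊆-trans W⊆P P⊆X))
             (AllPairs.zipWith (λ (¬fwd , either) → [ ⊥-elim ∘ ¬fwd , id ]′ either)
                               (nonForward , AllPairs-resp-⊆ W⊆P crossed))
    ... | v , v∈ , dominated =
      noDominatingPartner (⊆-lookup (⊆-trans W⊆P P⊆X) v∈) (⊆-trans W⊆P P⊆X) |W| dominated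

    linkedClique⇒CliqueOrCopy : ∀ {Q} → Q ⊆ X → linkedSize ≤ length Q → AllPairs Linked Q →
                                CliqueOrCopy
    linkedClique⇒CliqueOrCopy Q⊆X big linked
      with ramsey (λ u v → red? χ (g u) (g v)) K (ramseyBound s s) _ big
    ... | Z , _   , inj₁ (|Z| , clique)     =
      inj₁ (map g Z , trans (length-map g Z) |Z| , AllPairs.map⁺ clique)
    ... | P , P⊆Q , inj₂ (|P| , nonRedImage) =
      ⊥-elim (noCrossedSet (⊆-trans P⊆Q Q⊆X) (≤-reflexive (≡-sym |P|))
               (AllPairs.zipWith (λ (¬red , link) → [ ⊥-elim ∘ ¬red , id ]′ link)
                                 (nonRedImage , AllPairs-resp-⊆ P⊆Q linked)))

    partners⇒CliqueOrCopy : length X ≡ anchorCount → CliqueOrCopy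
    partners⇒CliqueOrCopy |X| with ramsey linked? linkedSize r X (≤-reflexive (≡-sym |X|))
    ... | Q , Q⊆X , inj₁ (|Q| , linked)   =
      linkedClique⇒CliqueOrCopy Q⊆X (≤-reflexive (≡-sym |Q|)) linked
    ... | M , M⊆X , inj₂ (|M| , unlinked) =
      inj₂ (inj₁ (matchingCopy χ g (≤-reflexive (≡-sym |M|)) (All.map proj₁ (All-resp-⊆ M⊆X partner))
        (AllPairs-map-∈ (λ u∈ v∈ (blue , ¬link) →
                           unlinked⇒separated (⊆-lookup M⊆X u∈) (⊆-lookup M⊆X v∈) blue ¬link)
                        (AllPairs.zip (AllPairs-resp-⊆ M⊆X X-indep , unlinked)))))

  anchors⇒CliqueOrCopy : ∀ {X} → AllPairs (Edge χ false) X →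
                         (∀ {x} → x ∈ X → degreeThreshold ≤ redDegree χ x) →
                         length X ≡ anchorCount → CliqueOrCopy
  anchors⇒CliqueOrCopy {X} X-indep high |X|
    with sequence-⊎ X (λ x∈ → partnerOrCliqueOrCopy X-indep |X| (high x∈))
  ... | inj₁ outcome  = outcome
  ... | inj₂ partners with All-choice Fin._≟_ id partners
  ...   | g , partner = Partners.partners⇒CliqueOrCopy X-indep g partner |X|

  cliqueOrCopy : 1 ≤ n → edgeDensity * n ≤ eR χ → CliqueOrCopy
  cliqueOrCopy n≥1 dense
    with ramsey (red? χ) K anchorCount (highVertices χ degreeThreshold) (manyHighVertices χ n≥1 dense)
  ... | Z , _   , inj₁ clique           = inj₁ (Z , clique)
  ... | X , X⊆H , inj₂ (|X| , nonRed) =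
    anchors⇒CliqueOrCopy X-indep (All.lookup (All-resp-⊆ X⊆H (all-filter _ (allFin n)))) |X|
    where
      X-indep : AllPairs (Edge χ false) X
      X-indep = nonRed⇒Blue χ (⊆-allFin-distinct (⊆-trans X⊆H (filter-⊆ _ (allFin n)))) nonRed

module _ {n : ℕ} (χ : Coloring n) where

  open import Data.List.Membership.DecPropositional (Fin._≟_ {n}) using (_∈?_)

  swap⇒Edge : ∀ {c u v} → Edge (swapColours χ) c u v → Edge χ (not c) u v
  swap⇒Edge {c} (u≢v , e) = u≢v , trans (≡-sym (not-involutive _)) (cong not e)

  Edge⇒swap : ∀ {c u v} → Edge χ c u v → Edge (swapColours χ) (not c) u v
  Edge⇒swap (u≢v , e) = u≢v , cong not e

  blueInRedClique≤1 : ∀ {W B} → AllPairs (Edge χ false) W → AllPairs (Red χ) B → All (_∈ B) W →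
                      length W ≤ 1
  blueInRedClique≤1 []                 _        _                  = z≤n
  blueInRedClique≤1 (_ ∷ [])           _        _                  = s≤s z≤n
  blueInRedClique≤1 ((blue ∷ _) ∷ _ ∷ _) B-clique (w₁∈ ∷ w₂∈ ∷ _) =
    ⊥-elim (Red⇒¬Blue χ (AllPairs-∈ (Edge-sym χ) B-clique w₁∈ w₂∈ (proj₁ blue)) blue)

  completeSplit : ∀ {t A Z} → AllPairs (Red χ) A → AllPairs (Edge χ false) Z →
                  (∀ {p} → p ∈ A → All (Red χ p) Z) → t ≤ length A → t ≤ length Z →
                  InducedMono χ (Ssplit t)
  completeSplit A-clique Z-indep complete =
    splitCopy χ A-clique Z-indep (λ u∈ v∈ → All.lookup (complete u∈) v∈)

  -- Z meets the red clique B in at most one vertex, hence the bound suc t on Z.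
  anticompleteSplit : ∀ {t B Z} → AllPairs (Red χ) B → AllPairs (Edge χ false) Z →
                      (∀ {p} → p ∈ B → All (λ z → ¬ Red χ p z) Z) →
                      t ≤ length B → suc t ≤ length Z →
                      InducedMono χ (Ssplit t)
  anticompleteSplit {t} {B} {Z} B-clique Z-indep anticomplete t≤B t<Z =
    InducedMono-swap χ (Ssplit t)
      (splitCopy (swapColours χ) (AllPairs.map Edge⇒swap (AllPairs.filter⁺ (∁? (_∈? B)) Z-indep))
                 (AllPairs.map Edge⇒swap B-clique) between t≤Z′ t≤B)
    where
      Z′ = filter (∁? (_∈? B)) Z

      between : Between (swapColours χ) true Z′ B
      between {z} {p} z∈ p∈ =
        Edge⇒swap (Edge-sym χ (¬Red⇒Blue χ p≢z
          (All.lookup (anticomplete p∈) (⊆-lookup (filter-⊆ _ Z) z∈))))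
        where
          p≢z : p ≢ z
          p≢z p≡z = All.lookup (all-filter (∁? (_∈? B)) Z) z∈ (subst (_∈ B) p≡z p∈)

      t≤Z′ : t ≤ length Z′
      t≤Z′ = s≤s⁻¹ (begin
        suc t                                    ≤⟨ t<Z ⟩
        length Z                                 ≡⟨ ≡-sym (length-filter-∁ (_∈? B) Z) ⟩
        length (filter (_∈? B) Z) + length Z′    ≤⟨ +-monoˡ-≤ (length Z′) Z∩B≤1 ⟩
        suc (length Z′)                          ∎)
        where
          open ≤-Reasoning
          Z∩B≤1 : length (filter (_∈? B) Z) ≤ 1
          Z∩B≤1 = blueInRedClique≤1 (AllPairs.filter⁺ (_∈? B) Z-indep) B-clique (all-filter (_∈? B) Z)

  splitFromHomogeneous : ∀ {t P Z} → AllPairs (Red χ) P → AllPairs (Edge χ false) Z →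
                         All (λ p → Homogeneous (Red χ) p Z) P → t + t ≤ length P → suc t ≤ length Z →
                         InducedMono χ (Ssplit t)
  splitFromHomogeneous {P = P} {Z} P-clique Z-indep homogeneous 2t≤P t<Z
    with filter-pigeonhole (λ p → all? (red? χ p) Z) P 2t≤P
  ... | inj₁ many =
    completeSplit (AllPairs.filter⁺ _ P-clique) Z-indep (All.lookup (all-filter _ P)) many (<⇒≤ t<Z)
  ... | inj₂ many = anticompleteSplit (AllPairs.filter⁺ _ P-clique) Z-indep anticomplete many t<Z
    where
      anticomplete : ∀ {p} → p ∈ filter (∁? (λ p → all? (red? χ p) Z)) P →
                     All (λ z → ¬ Red χ p z) Z
      anticomplete p∈ with All.lookup homogeneous (⊆-lookup (filter-⊆ _ P) p∈)
      ... | inj₁ allRed    = ⊥-elim (All.lookup (all-filter _ P) p∈ allRed)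
      ... | inj₂ allNonRed = allNonRed

  splitFromCliques : ∀ {t Q I} → AllPairs (Red χ) Q → AllPairs (Red (swapColours χ)) I →
                     t + t ≤ length Q → 2 ^ (t + t) * suc t ≤ length I → InducedMono χ (Ssplit t)
  splitFromCliques {t} {Q} {I} Q-clique I-clique 2t≤Q bound
    with homogeneousSublist (red? χ) (take (t + t) Q) (suc t) I
           (subst (λ k → 2 ^ k * suc t ≤ length I) (≡-sym (length-take-≤ 2t≤Q)) bound)
  ... | Z , Z⊆I , t<Z , homogeneous =
    splitFromHomogeneous (AllPairs.take⁺ (t + t) Q-clique)
      (AllPairs-resp-⊆ Z⊆I (AllPairs.map swap⇒Edge I-clique)) homogeneous
      (≤-reflexive (≡-sym (length-take-≤ 2t≤Q))) t<Z

theorem2p6 : (r s t : ℕ) → 2 ≤ r → 2 ≤ s → s ≤ t →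
    Σ ℕ λ C → Σ ℕ λ N → (n : ℕ) → N ≤ n → (χ : Coloring n) →
      C * n ≤ eR χ ⊓ eB χ →
      ¬ InducedMono χ (matching r) →
      InducedMono χ (Kbip s t) ⊎ InducedMono χ (Ssplit t)
theorem2p6 r (suc s′) (suc t′) _ (s≤s _) (s≤s _) = C , 1 , main
  where
    t K′ C : ℕ
    t  = suc t′
    -- a red K-clique contains the 2t pivots of splitFromCliques, a blue one survives refining against them
    K′ = t + t + 2 ^ (t + t) * suc t
    C  = Bounds.edgeDensity r (suc s′) t (suc K′)

    main : ∀ n → 1 ≤ n → (χ : Coloring n) → C * n ≤ eR χ ⊓ eB χ → ¬ InducedMono χ (matching r) →
           InducedMono χ (Kbip (suc s′) t) ⊎ InducedMono χ (Ssplit t)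
    main n n≥1 χ dense noMatching
      with DenseRedGraph.cliqueOrCopy χ r s′ t′ K′ n≥1 (≤-trans dense (m⊓n≤m _ _))
         | DenseRedGraph.cliqueOrCopy (swapColours χ) r s′ t′ K′ n≥1 (≤-trans dense (m⊓n≤n _ _))
    ... | inj₂ (inj₁ red-matching) | _                         = ⊥-elim (noMatching red-matching)
    ... | inj₂ (inj₂ red-kbip)     | _                         = inj₁ red-kbip
    ... | inj₁ _                   | inj₂ (inj₁ blue-matching) =
      ⊥-elim (noMatching (InducedMono-swap χ _ blue-matching))
    ... | inj₁ _                   | inj₂ (inj₂ blue-kbip)     = inj₁ (InducedMono-swap χ _ blue-kbip)
    ... | inj₁ (Q , |Q| , Q-clique) | inj₁ (I , |I| , I-clique) =
      inj₂ (splitFromCliques χ {t} Q-clique I-clique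
              (≤-trans (m≤m+n (t + t) _) (≤-trans (n≤1+n K′) (≤-reflexive (≡-sym |Q|))))
              (≤-trans (m≤n+m _ (t + t)) (≤-trans (n≤1+n K′) (≤-reflexive (≡-sym |I|)))))
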